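{- Let $B$ be a graph and $\Psi=\{[\psi^1_{/B}],\dots,[\psi^m_{/B}]\}$ a finite set of isomorphism classes of $B$-graphs such that $\Psi^+_{<r}$ is finite for all $r\in\mathbb N$; let $s$ be the largest number of edges among $\psi^1,\dots,\psi^m$. (1) If $[\psi_{/B}]\in\Psi^+$ and $G_{/B}$ is any $B$-graph, then every injective morphism $\psi_{/B}\to G_{/B}$ factors as an injective morphism $\psi_{/B}\to\Psi^+\cap G_{/B}$ followed by the inclusion $\Psi^+\cap G_{/B}\subset G_{/B}$. (2) If $r\in\mathbb N$, $G_{/B}$ is a $B$-graph with $\mathrm{ord}_\Psi(G)\ge r$, and $[\psi_{/B}]\in\Psi^+_{<r}$, then every injective morphism $\psi_{/B}\to G_{/B}$ factors as injective morphisms $\psi_{/B}\to\psi'_{/B}\to G_{/B}$ where $[\psi'_{/B}]\in\Psi^+_{<r+s}\setminus\Psi^+_{<r}$ (i.e. $\psi'$ lies in $\Psi^+$ and has order between $r$ and $r+s-1$). In particular $$N(\psi_{/B},G_{/B})\le\sum_{[\psi'_{/B}]\in\Psi^+_{<r+s}\setminus\Psi^+_{<r}}N(\psi_{/B},\psi'_{/B})\,N(\psi'_{/B},G_{/B}).$$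
   Context: All graphs are finite. A graph $G$ consists of finite sets $V_G,E^{\mathrm{dir}}_G$, maps $h_G,t_G\colon E^{\mathrm{dir}}_G\to V_G$ and an involution $\iota_G$ with $t_G\iota_G=h_G$; edges $E_G$ are the $\iota_G$-orbits; $\mathrm{ord}(G)=\#E_G-\#V_G$. A $B$-graph is a graph with a morphism (map on vertices and directed edges compatible with heads, tails, involutions) to $B$; morphisms of $B$-graphs commute with these maps; an injective morphism is injective on vertices and edges; $N(\psi_{/B},G_{/B})$ is the number of injective morphisms $\psi_{/B}\to G_{/B}$; $[\psi_{/B}]$ denotes the isomorphism class. $\Psi^+$ is the set of isomorphism classes $[\psi_{/B}]$ of $B$-graphs such that $\psi_{/B}$ is the union of one or more $B$-subgraphs each isomorphic to some $\psi^i_{/B}$; $\Psi^+_{<r}$ is the set of those with $\mathrm{ord}(\psi)<r$. For a $B$-graph $G_{/B}$, $\Psi^+\cap G_{/B}$ is the union of all $B$-subgraphs of $G_{/B}$ lying in some class of $\Psi$, and $\mathrm{ord}_\Psi(G)=\mathrm{ord}(\Psi^+\cap G_{/B})$. -}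

module Defs where

open import Data.Nat using (ℕ; zero; suc; _⊔_)
open import Data.Fin using (Fin; toℕ; _≟_)
open import Data.Fin.Properties using (all?; any?)
open import Data.Bool using (Bool; true; false; if_then_else_; _∧_)
open import Data.List using (List; allFin; map; foldr)
open import Data.Nat.ListAction using (sum)
open import Data.Bool.ListAction using (any)
open import Data.Integer using (ℤ; _⊖_)
open import Data.Product using (Σ; ∃; _×_; _,_)
open import Data.Vec.Functional using (_∷_)
open import Relation.Binary.PropositionalEquality using (_≡_)
open import Relation.Nullary using (Dec; does)
open import Relation.Nullary.Decidable using (_×-dec_; _→-dec_)
import Data.Nat as ℕ

-- Finite graphs: V_G = Fin nV, E^dir_G = Fin nD, heads h, tails t,
-- involution ι (fixed points allowed: half-loops) with t ∘ ι = h.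

record Graph : Set where
  field
    nV nD    : ℕ
    h t      : Fin nD → Fin nV
    ι        : Fin nD → Fin nD
    ι-invol  : ∀ d → ι (ι d) ≡ d
    tι≡h     : ∀ d → t (ι d) ≡ h d
open Graph public

record BGraph (B : Graph) : Set where
  field
    gr  : Graph
    πV  : Fin (nV gr) → Fin (nV B)
    πD  : Fin (nD gr) → Fin (nD B)
    πh  : ∀ d → πV (h gr d) ≡ h B (πD d)
    πt  : ∀ d → πV (t gr d) ≡ t B (πD d)
    πι  : ∀ d → πD (ι gr d) ≡ ι B (πD d)
open BGraph public

module _ {B : Graph} where

  IsMorB : (ψ G : BGraph B) → (Fin (nV (gr ψ)) → Fin (nV (gr G)))
         → (Fin (nD (gr ψ)) → Fin (nD (gr G))) → Set
  IsMorB ψ G fV fD =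
    (∀ d → fV (h (gr ψ) d) ≡ h (gr G) (fD d)) ×
    (∀ d → fV (t (gr ψ) d) ≡ t (gr G) (fD d)) ×
    (∀ d → fD (ι (gr ψ) d) ≡ ι (gr G) (fD d)) ×
    (∀ v → πV G (fV v) ≡ πV ψ v) ×
    (∀ d → πD G (fD d) ≡ πD ψ d)

  Inj : ∀ {a b} → (Fin a → Fin b) → Set
  Inj f = ∀ x y → f x ≡ f y → x ≡ y

  Surj : ∀ {a b} → (Fin a → Fin b) → Set
  Surj f = ∀ y → ∃ λ x → f x ≡ y

  IsInjMorB : (ψ G : BGraph B) → (Fin (nV (gr ψ)) → Fin (nV (gr G)))
            → (Fin (nD (gr ψ)) → Fin (nD (gr G))) → Set
  IsInjMorB ψ G fV fD = IsMorB ψ G fV fD × Inj fV × Inj fD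

  record InjMorB (ψ G : BGraph B) : Set where
    constructor injMor
    field
      fV    : Fin (nV (gr ψ)) → Fin (nV (gr G))
      fD    : Fin (nD (gr ψ)) → Fin (nD (gr G))
      isInj : IsInjMorB ψ G fV fD
  open InjMorB public

  Iso : (ψ G : BGraph B) → Set
  Iso ψ G = Σ (InjMorB ψ G) λ f → Surj (fV f) × Surj (fD f)

  inj? : ∀ {a b} (f : Fin a → Fin b) → Dec (Inj f)
  inj? f = all? λ x → all? λ y → (f x ≟ f y) →-dec (x ≟ y)

  isInjMorB? : (ψ G : BGraph B) → ∀ fV fD → Dec (IsInjMorB ψ G fV fD)
  isInjMorB? ψ G fV fD =
    ((all? λ d → fV (h (gr ψ) d) ≟ h (gr G) (fD d)) ×-dec
     ((all? λ d → fV (t (gr ψ) d) ≟ t (gr G) (fD d)) ×-dec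
      ((all? λ d → fD (ι (gr ψ) d) ≟ ι (gr G) (fD d)) ×-dec
       ((all? λ v → πV G (fV v) ≟ πV ψ v) ×-dec
        (all? λ d → πD G (fD d) ≟ πD ψ d)))))
    ×-dec (inj? fV ×-dec inj? fD)

-- Summation / existence over all functions Fin a → Fin b
-- (each function enumerated exactly once, as a table of values)

sumF : ∀ a b → ((Fin a → Fin b) → ℕ) → ℕ
sumF zero    b w = w (λ ())
sumF (suc a) b w = sum (map (λ i → sumF a b (λ f → w (i ∷ f))) (allFin b))

anyF : ∀ a b → ((Fin a → Fin b) → Bool) → Bool
anyF zero    b P = P (λ ())
anyF (suc a) b P = any (λ i → anyF a b (λ f → P (i ∷ f))) (allFin b)

countFin : ∀ n → (Fin n → Bool) → ℕ
countFin n P = sum (map (λ x → if P x then 1 else 0) (allFin n))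

-- number of edges (ι-orbits): one representative d with toℕ d ≤ toℕ (ι d)
-- per orbit; order ord(G) = #E − #V

isOrbitRep : (G : Graph) → Fin (nD G) → Bool
isOrbitRep G d = does (toℕ d ℕ.≤? toℕ (ι G d))

numEdges : Graph → ℕ
numEdges G = countFin (nD G) (isOrbitRep G)

ord : Graph → ℤ
ord G = numEdges G ⊖ nV G

module _ {B : Graph} where

  N : (ψ G : BGraph B) → ℕ
  N ψ G = sumF (nV (gr ψ)) (nV (gr G)) λ fV →
          sumF (nD (gr ψ)) (nD (gr G)) λ fD →
          if does (isInjMorB? ψ G fV fD) then 1 else 0

  -- Ψ = {[ψ^1],…,[ψ^m]} given by representatives Ψ : Fin m → BGraph B.

  -- [ψ] ∈ Ψ^+ : ψ is the union of one or more B-subgraphs each isomorphic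
  -- to some ψ^i.  A B-subgraph of ψ isomorphic to ψ^i is exactly the image
  -- of an injective morphism ψ^i → ψ; "union" = the images cover all
  -- vertices and all directed edges of ψ.
  InΨ+ : ∀ {m} → (Fin m → BGraph B) → BGraph B → Set
  InΨ+ {m} Ψ ψ =
    Σ ℕ λ k → Σ (Fin (suc k) → Fin m) λ idx →
    Σ ((j : Fin (suc k)) → InjMorB (Ψ (idx j)) ψ) λ φ →
      (∀ v → ∃ λ j → ∃ λ x → fV (φ j) x ≡ v) ×
      (∀ d → ∃ λ j → ∃ λ e → fD (φ j) e ≡ d)

  -- Ψ^+ ∩ G : the union of all B-subgraphs of G lying in some class of Ψ,
  -- given by its vertex set and directed-edge set (images of injective
  -- morphisms ψ^i → G).
  coreV : ∀ {m} → (Fin m → BGraph B) → (G : BGraph B) → Fin (nV (gr G)) → Bool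
  coreV {m} Ψ G v = any (λ i →
    anyF (nV (gr (Ψ i))) (nV (gr G)) λ fV →
    anyF (nD (gr (Ψ i))) (nD (gr G)) λ fD →
      does (isInjMorB? (Ψ i) G fV fD) ∧ does (any? λ x → fV x ≟ v)) (allFin m)

  coreD : ∀ {m} → (Fin m → BGraph B) → (G : BGraph B) → Fin (nD (gr G)) → Bool
  coreD {m} Ψ G d = any (λ i →
    anyF (nV (gr (Ψ i))) (nV (gr G)) λ fV →
    anyF (nD (gr (Ψ i))) (nD (gr G)) λ fD →
      does (isInjMorB? (Ψ i) G fV fD) ∧ does (any? λ e → fD e ≟ d)) (allFin m)

  ordΨ : ∀ {m} → (Fin m → BGraph B) → BGraph B → ℤ
  ordΨ Ψ G =
    countFin (nD (gr G)) (λ d → coreD Ψ G d ∧ isOrbitRep (gr G) d)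
    ⊖ countFin (nV (gr G)) (coreV Ψ G)

  -- an injective morphism ψ → G factors through the inclusion Ψ^+∩G ⊂ G
  -- iff its image lies in Ψ^+ ∩ G
  FactorsThroughCore : ∀ {m} → (Fin m → BGraph B) → {ψ G : BGraph B}
                     → InjMorB ψ G → Set
  FactorsThroughCore Ψ {ψ} {G} f =
    (∀ v → coreV Ψ G (fV f v) ≡ true) × (∀ d → coreD Ψ G (fD f d) ≡ true)

  FiniteΨ+< : ∀ {m} → (Fin m → BGraph B) → ℕ → Set
  FiniteΨ+< Ψ r = Σ ℕ λ n → Σ (Fin n → BGraph B) λ reps →
    ∀ ψ → InΨ+ Ψ ψ → ord (gr ψ) Data.Integer.< Data.Integer.+ r →
    ∃ λ j → Iso ψ (reps j)

  maxEdges : ∀ {m} → (Fin m → BGraph B) → ℕ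
  maxEdges {m} Ψ = foldr _⊔_ 0 (map (λ i → numEdges (gr (Ψ i))) (allFin m))

  IsRepSystem : ∀ {m} → (Fin m → BGraph B) → (a b : ℕ) → ∀ {n}
              → (Fin n → BGraph B) → Set
  IsRepSystem Ψ a b {n} reps =
    (∀ j → InΨ+ Ψ (reps j) × Data.Integer.+ a Data.Integer.≤ ord (gr (reps j))
                           × ord (gr (reps j)) Data.Integer.< Data.Integer.+ b) ×
    (∀ j k → Iso (reps j) (reps k) → j ≡ k) ×
    (∀ ψ → InΨ+ Ψ ψ → Data.Integer.+ a Data.Integer.≤ ord (gr ψ)
         → ord (gr ψ) Data.Integer.< Data.Integer.+ b → ∃ λ j → Iso ψ (reps j))

sumFin : ∀ n → (Fin n → ℕ) → ℕ
sumFin n w = sum (map w (allFin n))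

-- (1) Ψ⁺ ∩ G contains the image of every injective morphism ψⁱ → G, and ψ ∈ Ψ⁺ is covered by images of
-- the ψⁱ, so the image of f is covered by images of composites ψⁱ → ψ → G.
-- (2) Grow the subgraph f(ψ) of G by adding, one at a time, images of injective morphisms ψⁱ → G until all of
-- Ψ⁺ ∩ G is covered. Since ψ is a union of copies of the ψⁱ, every stage is such a union and so lies in Ψ⁺.
-- The order starts at most ord ψ < r and ends at least ord_Ψ G ≥ r; a step adds at most s edges and loses no
-- vertex, so the first stage of order ≥ r has order < r + s: this is ψ′. For the inequality, transport
-- ψ → ψ′ → G to the chosen representative of [ψ′]; f is recovered as the composite, so f ↦ (a , b) is injective.

module Submission where

open import Defs
open import Data.Nat using (ℕ; zero; suc; _+_; _*_; _≤_; _<_; _⊔_; z≤n; s≤s)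
open import Data.Nat.Properties
  using ( ≤-refl; ≤-trans; ≤-reflexive; ≤-antisym; <⇒≤; <-irrefl; <⇒≱; ≰⇒>; <-cmp; ≤-<-connex
        ; ≤⇒≤ᵇ; ≤ᵇ⇒≤; m≤m+n; m≤n+m; +-commutativeSemigroup; n≤1+n; m≤m⊔n; m≤n⊔m; +-mono-≤; +-monoʳ-≤; +-suc
        ; *-monoʳ-≤; *-identityʳ; *-zeroʳ; *-comm; *-distribˡ-+; module ≤-Reasoning)
  renaming (_≤?_ to _≤ℕ?_)
open import Algebra.Properties.CommutativeSemigroup +-commutativeSemigroup
  using () renaming (interchange to +-interchange)
open import Data.Fin using (Fin; zero; suc; toℕ; _≟_)
open import Data.Fin.Properties using (all?; any?; toℕ-injective; injective⇒≤)
open import Data.Bool using (Bool; true; false; T; if_then_else_; _∧_; _∨_)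
open import Data.Bool.Properties using (T-≡; T-∧; T-∨)
open import Data.Integer using (ℤ; +_; _⊖_) renaming (_≤_ to _≤ℤ_; _<_ to _<ℤ_; _+_ to _+ℤ_)
import Data.Integer.Properties as ℤ
import Data.Product
open import Data.Product using (Σ; ∃; _×_; _,_; proj₁; proj₂)
open import Data.Sum using (_⊎_; inj₁; inj₂)
open import Data.List using (List; []; _∷_; _++_; map; concatMap; foldr; tabulate; allFin; lookup; length)
open import Data.Nat.ListAction using (sum)
open import Data.Bool.ListAction using (any)
open import Data.List.Properties using (map-tabulate; tabulate-cong)
open import Data.List.Membership.Propositional using (_∈_)
open import Data.List.Membership.Propositional.Properties using (∈-allFin; ∈-lookup; ∈-++⁺ʳ; ∈-map⁺)
open import Data.Vec.Functional using () renaming (_∷_ to _∷ᶠ_)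
open import Data.List.Relation.Unary.Any as Any using (Any; here; there; satisfied)
open import Data.List.Relation.Unary.Any.Properties using (any⁺; any⁻; lookup-index; concatMap⁺; ++⁺ˡ; map⁻)
open import Function using (_∘_; _⇔_; Equivalence; mk⇔)
open import Relation.Binary.PropositionalEquality
  using (_≡_; _≗_; refl; sym; trans; cong; cong₂; subst; module ≡-Reasoning)
open import Relation.Binary.Definitions using (tri<; tri≈; tri>)
open import Relation.Nullary using (Dec; yes; no; does)
open import Relation.Nullary.Decidable using (dec-true; dec-false; T?)
open import Data.Empty using (⊥-elim)

does⁺ : ∀ {P : Set} (P? : Dec P) → P → T (does P?)
does⁺ P? p = Equivalence.from T-≡ (dec-true P? p)

does⁻ : ∀ {P : Set} (P? : Dec P) → T (does P?) → P
does⁻ (yes p) _ = p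

T-injective : ∀ {a b} → T a ⇔ T b → a ≡ b
T-injective {false} {false} _   = refl
T-injective {true}  {true}  _   = refl
T-injective {false} {true}  a⇔b = ⊥-elim (Equivalence.from a⇔b _)
T-injective {true}  {false} a⇔b = ⊥-elim (Equivalence.to a⇔b _)

𝟙 : Bool → ℕ
𝟙 b = if b then 1 else 0

𝟙-mono : ∀ {a b} → (T a → T b) → 𝟙 a ≤ 𝟙 b
𝟙-mono {false}         _   = z≤n
𝟙-mono {true}  {true}  _   = ≤-refl
𝟙-mono {true}  {false} a⇒b = ⊥-elim (a⇒b _)

𝟙-does-mono : ∀ {P Q : Set} (P? : Dec P) (Q? : Dec Q) → (P → Q) → 𝟙 (does P?) ≤ 𝟙 (does Q?)
𝟙-does-mono (no _)  _        _   = z≤n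
𝟙-does-mono (yes _) (yes _)  _   = ≤-refl
𝟙-does-mono (yes p) (no ¬q)  P⇒Q = ⊥-elim (¬q (P⇒Q p))

𝟙-does≡1 : ∀ {P : Set} (P? : Dec P) → P → 𝟙 (does P?) ≡ 1
𝟙-does≡1 P? p = cong 𝟙 (dec-true P? p)

-- Counting subsets of Fin n

count : ∀ n → (Fin n → Bool) → ℕ
count n P = sum (tabulate (𝟙 ∘ P))

countFin≡count : ∀ n P → countFin n P ≡ count n P
countFin≡count n P = cong sum (map-tabulate (λ x → x) (𝟙 ∘ P))

count-cong : ∀ n {P Q : Fin n → Bool} → P ≗ Q → count n P ≡ count n Q
count-cong n P≗Q = cong sum (tabulate-cong (cong 𝟙 ∘ P≗Q))

count-mono : ∀ n {P Q : Fin n → Bool} → (∀ x → T (P x) → T (Q x)) → count n P ≤ count n Q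
count-mono zero    P⊆Q = z≤n
count-mono (suc n) P⊆Q = +-mono-≤ (𝟙-mono (P⊆Q zero)) (count-mono n (P⊆Q ∘ suc))

count-∨ : ∀ n (P Q : Fin n → Bool) → count n (λ x → P x ∨ Q x) ≤ count n P + count n Q
count-∨ zero    P Q = z≤n
count-∨ (suc n) P Q with P zero | Q zero
... | true  | true  = s≤s (≤-trans (count-∨ n _ _) (+-monoʳ-≤ (count n (P ∘ suc)) (n≤1+n _)))
... | true  | false = s≤s (count-∨ n _ _)
... | false | true  = ≤-trans (s≤s (count-∨ n _ _)) (≤-reflexive (sym (+-suc _ _)))
... | false | false = count-∨ n _ _

count-true : ∀ n → count n (λ _ → true) ≡ n
count-true zero    = refl
count-true (suc n) = cong suc (count-true n)

select : ∀ n (P : Fin n → Bool) → Fin (count n P) → Fin n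
select (suc n) P x with P zero
select (suc n) P zero    | true  = zero
select (suc n) P (suc x) | true  = suc (select n (P ∘ suc) x)
select (suc n) P x       | false = suc (select n (P ∘ suc) x)

select-satisfies : ∀ n (P : Fin n → Bool) x → T (P (select n P x))
select-satisfies (suc n) P x with P zero in P0
select-satisfies (suc n) P zero    | true  = Equivalence.from T-≡ P0
select-satisfies (suc n) P (suc x) | true  = select-satisfies n (P ∘ suc) x
select-satisfies (suc n) P x       | false = select-satisfies n (P ∘ suc) x

position : ∀ n (P : Fin n → Bool) v → T (P v) → Fin (count n P)
position (suc n) P zero    Pv with P zero
... | true  = zero
position (suc n) P (suc v) Pv with P zero
... | true  = suc (position n (P ∘ suc) v Pv)
... | false = position n (P ∘ suc) v Pv

select-position : ∀ n (P : Fin n → Bool) v Pv → select n P (position n P v Pv) ≡ v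
select-position (suc n) P zero    Pv with P zero
... | true  = refl
select-position (suc n) P (suc v) Pv with P zero
... | true  = cong suc (select-position n (P ∘ suc) v Pv)
... | false = cong suc (select-position n (P ∘ suc) v Pv)

select-strictMono : ∀ n (P : Fin n → Bool) x y → toℕ x < toℕ y → toℕ (select n P x) < toℕ (select n P y)
select-strictMono (suc n) P x y x<y with P zero
select-strictMono (suc n) P zero    (suc y) _         | true  = s≤s z≤n
select-strictMono (suc n) P (suc x) (suc y) (s≤s x<y) | true  = s≤s (select-strictMono n (P ∘ suc) x y x<y)
select-strictMono (suc n) P x       y       x<y       | false = s≤s (select-strictMono n (P ∘ suc) x y x<y)

select-injective : ∀ n (P : Fin n → Bool) x y → select n P x ≡ select n P y → x ≡ y
select-injective n P x y eq with <-cmp (toℕ x) (toℕ y)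
... | tri< x<y _ _ = ⊥-elim (<-irrefl (cong toℕ eq) (select-strictMono n P x y x<y))
... | tri≈ _ x≡y _ = toℕ-injective x≡y
... | tri> _ _ y<x = ⊥-elim (<-irrefl (cong toℕ (sym eq)) (select-strictMono n P y x y<x))

select-≤⇔ : ∀ n (P : Fin n → Bool) x y → toℕ x ≤ toℕ y ⇔ toℕ (select n P x) ≤ toℕ (select n P y)
select-≤⇔ n P x y = mk⇔ to from
  where
  to : toℕ x ≤ toℕ y → toℕ (select n P x) ≤ toℕ (select n P y)
  to x≤y with <-cmp (toℕ x) (toℕ y)
  ... | tri< x<y _ _ = <⇒≤ (select-strictMono n P x y x<y)
  ... | tri≈ _ x≡y _ rewrite toℕ-injective x≡y = ≤-refl
  ... | tri> _ _ y<x = ⊥-elim (<⇒≱ y<x x≤y)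
  from : toℕ (select n P x) ≤ toℕ (select n P y) → toℕ x ≤ toℕ y
  from sx≤sy with ≤-<-connex (toℕ x) (toℕ y)
  ... | inj₁ x≤y = x≤y
  ... | inj₂ y<x = ⊥-elim (<⇒≱ (select-strictMono n P y x y<x) sx≤sy)

count-select : ∀ n (P Q : Fin n → Bool) → count (count n P) (Q ∘ select n P) ≡ count n (λ v → P v ∧ Q v)
count-select zero    P Q = refl
count-select (suc n) P Q with P zero
... | true  = cong (_+_ (𝟙 (Q zero))) (count-select n (P ∘ suc) (Q ∘ suc))
... | false = count-select n (P ∘ suc) (Q ∘ suc)

count-injection : ∀ n k (P : Fin n → Bool) (Q : Fin k → Bool) (g : ∀ x → T (P x) → Fin k)
  → (∀ x Px → T (Q (g x Px))) → (∀ x y Px Py → g x Px ≡ g y Py → x ≡ y)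
  → count n P ≤ count k Q
count-injection n k P Q g g∈Q g-inj = injective⇒≤ {f = g′} g′-injective
  where
  g′ : Fin (count n P) → Fin (count k Q)
  g′ z = position k Q (g (select n P z) (select-satisfies n P z)) (g∈Q _ _)
  g′-injective : ∀ {z z′} → g′ z ≡ g′ z′ → z ≡ z′
  g′-injective {z} {z′} eq = select-injective n P z z′ (g-inj _ _ _ _ (begin
    g (select n P z) _                           ≡⟨ select-position k Q _ _ ⟨
    select k Q (g′ z)                            ≡⟨ cong (select k Q) eq ⟩
    select k Q (g′ z′)                           ≡⟨ select-position k Q _ _ ⟩
    g (select n P z′) _                          ∎))
    where open ≡-Reasoning

-- Sums over lists and over function spaces

private
  variable
    A C : Set

sum-map-cong : ∀ (xs : List A) {u v : A → ℕ} → u ≗ v → sum (map u xs) ≡ sum (map v xs)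
sum-map-cong []       u≗v = refl
sum-map-cong (x ∷ xs) u≗v = cong₂ _+_ (u≗v x) (sum-map-cong xs u≗v)

sum-map-mono : ∀ (xs : List A) {u v : A → ℕ} → (∀ x → u x ≤ v x) → sum (map u xs) ≤ sum (map v xs)
sum-map-mono []       u≤v = z≤n
sum-map-mono (x ∷ xs) u≤v = +-mono-≤ (u≤v x) (sum-map-mono xs u≤v)

sum-map-zero : ∀ (xs : List A) → sum (map (λ _ → 0) xs) ≡ 0
sum-map-zero []       = refl
sum-map-zero (x ∷ xs) = sum-map-zero xs

sum-map-+ : ∀ (xs : List A) (u v : A → ℕ) → sum (map (λ x → u x + v x) xs) ≡ sum (map u xs) + sum (map v xs)
sum-map-+ []       u v = refl
sum-map-+ (x ∷ xs) u v = begin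
  (u x + v x) + sum (map (λ x → u x + v x) xs)       ≡⟨ cong (_+_ (u x + v x)) (sum-map-+ xs u v) ⟩
  (u x + v x) + (sum (map u xs) + sum (map v xs))   ≡⟨ +-interchange (u x) (v x) _ _ ⟩
  (u x + sum (map u xs)) + (v x + sum (map v xs))   ∎
  where open ≡-Reasoning

sum-map-*ˡ : ∀ (xs : List A) c (u : A → ℕ) → sum (map (λ x → c * u x) xs) ≡ c * sum (map u xs)
sum-map-*ˡ []       c u = sym (*-zeroʳ c)
sum-map-*ˡ (x ∷ xs) c u = trans (cong (_+_ (c * u x)) (sum-map-*ˡ xs c u)) (sym (*-distribˡ-+ c (u x) _))

∈⇒≤sum-map : ∀ (xs : List A) (u : A → ℕ) {x} → x ∈ xs → u x ≤ sum (map u xs)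
∈⇒≤sum-map (y ∷ xs) u (here refl) = m≤m+n _ _
∈⇒≤sum-map (y ∷ xs) u (there x∈xs) = ≤-trans (∈⇒≤sum-map xs u x∈xs) (m≤n+m _ _)

∈⇒≤foldr-⊔ : ∀ {x} (xs : List ℕ) → x ∈ xs → x ≤ foldr _⊔_ 0 xs
∈⇒≤foldr-⊔ (y ∷ xs) (here refl)  = m≤m⊔n _ _
∈⇒≤foldr-⊔ (y ∷ xs) (there x∈xs) = ≤-trans (∈⇒≤foldr-⊔ xs x∈xs) (m≤n⊔m y _)

sum-map-comm : ∀ (xs : List A) (ys : List C) (w : A → C → ℕ)
  → sum (map (λ x → sum (map (w x) ys)) xs) ≡ sum (map (λ y → sum (map (λ x → w x y) xs)) ys)
sum-map-comm []       ys w = sym (sum-map-zero ys)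
sum-map-comm (x ∷ xs) ys w =
  trans (cong (_+_ (sum (map (w x) ys))) (sum-map-comm xs ys w)) (sym (sum-map-+ ys (w x) _))

sumFin-suc : ∀ n (w : Fin (suc n) → ℕ) → sumFin (suc n) w ≡ w zero + sumFin n (w ∘ suc)
sumFin-suc n w = cong (_+_ (w zero)) (cong sum (trans (map-tabulate suc w) (sym (map-tabulate (λ i → i) (w ∘ suc)))))

sumFin-≟ : ∀ n (c : Fin n) → sumFin n (λ i → 𝟙 (does (i ≟ c))) ≡ 1
sumFin-≟ (suc n) zero    = trans (sumFin-suc n (λ i → 𝟙 (does (i ≟ zero)))) (cong suc (sum-map-zero (allFin n)))
sumFin-≟ (suc n) (suc c) = trans (sumFin-suc n (λ i → 𝟙 (does (i ≟ suc c)))) (sumFin-≟ n c)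

_≗?_ : ∀ {a b} (f g : Fin a → Fin b) → Dec (f ≗ g)
f ≗? g = all? λ x → f x ≟ g x

sumF-cong : ∀ a b {u v : (Fin a → Fin b) → ℕ} → u ≗ v → sumF a b u ≡ sumF a b v
sumF-cong zero    b u≗v = u≗v _
sumF-cong (suc a) b u≗v = sum-map-cong (allFin b) (λ i → sumF-cong a b (λ f → u≗v (i ∷ᶠ f)))

sumF-mono : ∀ a b {u v : (Fin a → Fin b) → ℕ} → (∀ f → u f ≤ v f) → sumF a b u ≤ sumF a b v
sumF-mono zero    b u≤v = u≤v _
sumF-mono (suc a) b u≤v = sum-map-mono (allFin b) (λ i → sumF-mono a b (λ f → u≤v (i ∷ᶠ f)))

sumF-*ˡ : ∀ a b c (u : (Fin a → Fin b) → ℕ) → sumF a b (λ f → c * u f) ≡ c * sumF a b u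
sumF-*ˡ zero    b c u = refl
sumF-*ˡ (suc a) b c u =
  trans (sum-map-cong (allFin b) (λ i → sumF-*ˡ a b c _)) (sum-map-*ˡ (allFin b) c _)

sumF-sum-map-comm : ∀ a b (ys : List A) (w : (Fin a → Fin b) → A → ℕ)
  → sumF a b (λ f → sum (map (w f) ys)) ≡ sum (map (λ y → sumF a b (λ f → w f y)) ys)
sumF-sum-map-comm zero    b ys w = refl
sumF-sum-map-comm (suc a) b ys w =
  trans (sum-map-cong (allFin b) (λ i → sumF-sum-map-comm a b ys (w ∘ (i ∷ᶠ_))))
        (sum-map-comm (allFin b) ys _)

sumF-comm : ∀ a b c d (w : (Fin a → Fin b) → (Fin c → Fin d) → ℕ)
  → sumF a b (λ f → sumF c d (w f)) ≡ sumF c d (λ g → sumF a b (λ f → w f g))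
sumF-comm zero    b c d w = refl
sumF-comm (suc a) b c d w =
  trans (sum-map-cong (allFin b) (λ i → sumF-comm a b c d (w ∘ (i ∷ᶠ_))))
        (sym (sumF-sum-map-comm c d (allFin b) (λ g i → sumF a b (λ f → w (i ∷ᶠ f) g))))

-- Functions are enumerated as tables, so the summand found for g is at a pointwise copy of g.
term≤sumF : ∀ a b (w : (Fin a → Fin b) → ℕ) (g : Fin a → Fin b) → ∃ λ f → f ≗ g × w f ≤ sumF a b w
term≤sumF zero    b w g = (λ ()) , (λ ()) , ≤-refl
term≤sumF (suc a) b w g with term≤sumF a b (w ∘ (g zero ∷ᶠ_)) (g ∘ suc)
... | f , f≗g∘suc , wf≤ = (g zero ∷ᶠ f) , (λ { zero → refl ; (suc x) → f≗g∘suc x }) ,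
      ≤-trans wf≤ (∈⇒≤sum-map (allFin b) (λ i → sumF a b (w ∘ (i ∷ᶠ_))) (∈-allFin (g zero)))

sumF-≗?-≤1 : ∀ a b (g : Fin a → Fin b) → sumF a b (λ f → 𝟙 (does (f ≗? g))) ≤ 1
sumF-≗?-≤1 zero    b g = ≤-refl
sumF-≗?-≤1 (suc a) b g = begin
  sumFin b (λ i → sumF a b (λ f → 𝟙 (does ((i ∷ᶠ f) ≗? g))))  ≤⟨ sum-map-mono (allFin b) column≤ ⟩
  sumFin b (λ i → 𝟙 (does (i ≟ g zero)))                     ≡⟨ sumFin-≟ b (g zero) ⟩
  1                                                          ∎
  where
  open ≤-Reasoning
  column≤ : ∀ i → sumF a b (λ f → 𝟙 (does ((i ∷ᶠ f) ≗? g))) ≤ 𝟙 (does (i ≟ g zero))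
  column≤ i = by-cases (i ≟ g zero)
    where
    by-cases : (i≟g₀ : Dec (i ≡ g zero)) → sumF a b (λ f → 𝟙 (does ((i ∷ᶠ f) ≗? g))) ≤ 𝟙 (does i≟g₀)
    by-cases (yes _) = ≤-trans (sumF-mono a b (λ f → 𝟙-does-mono ((i ∷ᶠ f) ≗? g) (f ≗? (g ∘ suc)) (_∘ suc)))
                               (sumF-≗?-≤1 a b (g ∘ suc))
    by-cases (no i≢g₀) = ≤-reflexive (trans
      (sumF-cong a b λ f → cong 𝟙 (dec-false ((i ∷ᶠ f) ≗? g) (λ i∷f≗g → i≢g₀ (i∷f≗g zero))))
      (sumF-*ˡ a b 0 (λ _ → 0)))

anyF⁺ : ∀ a b (P : (Fin a → Fin b) → Bool) g → (∀ f → f ≗ g → T (P f)) → T (anyF a b P)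
anyF⁺ zero    b P g Pg = Pg _ (λ ())
anyF⁺ (suc a) b P g Pg = any⁺ _ (Any.map (λ { refl → P∷ }) (∈-allFin (g zero)))
  where
  P∷ : T (anyF a b (P ∘ (g zero ∷ᶠ_)))
  P∷ = anyF⁺ a b (P ∘ (g zero ∷ᶠ_)) (g ∘ suc) λ f f≗ → Pg _ λ { zero → refl ; (suc x) → f≗ x }

anyF⁻ : ∀ a b (P : (Fin a → Fin b) → Bool) → T (anyF a b P) → ∃ λ f → T (P f)
anyF⁻ zero    b P Pf = _ , Pf
anyF⁻ (suc a) b P PF with satisfied (any⁻ _ (allFin b) PF)
... | i , Pi = let f , Pf = anyF⁻ a b (P ∘ (i ∷ᶠ_)) Pi in (i ∷ᶠ f) , Pf

⊖-mono-≤ : ∀ {a a′ b b′} → a ≤ a′ → b′ ≤ b → a ⊖ b ≤ℤ a′ ⊖ b′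
⊖-mono-≤ {a} {a′} {b} {b′} a≤a′ b′≤b = ℤ.≤-trans (ℤ.⊖-monoʳ-≥-≤ a b′≤b) (ℤ.⊖-monoˡ-≤ b′ a≤a′)

-- A discrete intermediate value theorem.
first-crossing : ∀ {A : Set} (O : List A → ℤ) (s : ℕ) (r : ℤ) → (∀ x ℓ → O (x ∷ ℓ) ≤ℤ O ℓ +ℤ + s)
  → O [] <ℤ r → ∀ ℓ → r ≤ℤ O ℓ → ∃ λ ℓ′ → r ≤ℤ O ℓ′ × O ℓ′ <ℤ r +ℤ + s
first-crossing O s r step O[]<r []      r≤O[] = ⊥-elim (ℤ.<⇒≱ O[]<r r≤O[])
first-crossing O s r step O[]<r (x ∷ ℓ) r≤Oxℓ with r ℤ.≤? O ℓ
... | yes r≤Oℓ = first-crossing O s r step O[]<r ℓ r≤Oℓ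
... | no  r≰Oℓ = x ∷ ℓ , r≤Oxℓ , ℤ.≤-<-trans (step x ℓ) (ℤ.+-monoˡ-< (+ s) (ℤ.≰⇒> r≰Oℓ))

-- Injective morphisms of B-graphs, and counting them

module _ {B : Graph} where

  IsInjMorB-resp-≗ : ∀ (χ G : BGraph B) {fV fV′ fD fD′} → IsInjMorB χ G fV fD
    → fV ≗ fV′ → fD ≗ fD′ → IsInjMorB χ G fV′ fD′
  IsInjMorB-resp-≗ χ G ((hom-h , hom-t , hom-ι , hom-πV , hom-πD) , injV , injD) eV eD =
    ( (λ d → trans (sym (eV _)) (trans (hom-h d) (cong (h (gr G)) (eD d))))
    , (λ d → trans (sym (eV _)) (trans (hom-t d) (cong (t (gr G)) (eD d))))
    , (λ d → trans (sym (eD _)) (trans (hom-ι d) (cong (ι (gr G)) (eD d))))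
    , (λ v → trans (cong (πV G) (sym (eV v))) (hom-πV v))
    , (λ d → trans (cong (πD G) (sym (eD d))) (hom-πD d)) )
    , (λ x y e → injV x y (trans (eV x) (trans e (sym (eV y)))))
    , (λ x y e → injD x y (trans (eD x) (trans e (sym (eD y)))))

  idᴹ : ∀ {χ : BGraph B} → InjMorB χ χ
  idᴹ = injMor (λ v → v) (λ d → d)
    (((λ _ → refl) , (λ _ → refl) , (λ _ → refl) , (λ _ → refl) , (λ _ → refl)) , (λ _ _ e → e) , (λ _ _ e → e))

  infixr 9 _∘ᴹ_
  _∘ᴹ_ : ∀ {χ ψ G : BGraph B} → InjMorB ψ G → InjMorB χ ψ → InjMorB χ G
  _∘ᴹ_ {χ} {ψ} {G} g f = injMor (fV g ∘ fV f) (fD g ∘ fD f) (composite (isInj g) (isInj f))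
    where
    composite : ∀ {gV gD fV fD} → IsInjMorB ψ G gV gD → IsInjMorB χ ψ fV fD
      → IsInjMorB χ G (gV ∘ fV) (gD ∘ fD)
    composite {gV = gV} {gD} {fV} {fD} ((gh , gt , gι , gπV , gπD) , ginjV , ginjD)
                                       ((fh , ft , fι , fπV , fπD) , finjV , finjD) =
      ( (λ d → trans (cong gV (fh d)) (gh (fD d)))
      , (λ d → trans (cong gV (ft d)) (gt (fD d)))
      , (λ d → trans (cong gD (fι d)) (gι (fD d)))
      , (λ v → trans (gπV (fV v)) (fπV v))
      , (λ d → trans (gπD (fD d)) (fπD d)) )
      , (λ x y e → finjV x y (ginjV _ _ e))
      , (λ x y e → finjD x y (ginjD _ _ e))

  infix 4 _≗ᴹ_
  _≗ᴹ_ : ∀ {χ G : BGraph B} → InjMorB χ G → InjMorB χ G → Set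
  f ≗ᴹ g = (fV f ≗ fV g) × (fD f ≗ fD g)

  Iso⇒leftInverse : ∀ {χ G : BGraph B} (I : Iso χ G) → Σ (InjMorB G χ) λ J → J ∘ᴹ proj₁ I ≗ᴹ idᴹ
  Iso⇒leftInverse {G = G} (injMor iV iD ((ih , it , iι , iπV , iπD) , injV , injD) , surjV , surjD) =
    injMor jV jD
      (( (λ d → injV _ _ (trans (iV∘jV _) (trans (cong (h (gr G)) (sym (iD∘jD d))) (sym (ih (jD d))))))
       , (λ d → injV _ _ (trans (iV∘jV _) (trans (cong (t (gr G)) (sym (iD∘jD d))) (sym (it (jD d))))))
       , (λ d → injD _ _ (trans (iD∘jD _) (trans (cong (ι (gr G)) (sym (iD∘jD d))) (sym (iι (jD d))))))
       , (λ v → trans (sym (iπV (jV v))) (cong (πV G) (iV∘jV v)))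
       , (λ d → trans (sym (iπD (jD d))) (cong (πD G) (iD∘jD d))) )
      , (λ x y e → trans (sym (iV∘jV x)) (trans (cong iV e) (iV∘jV y)))
      , (λ x y e → trans (sym (iD∘jD x)) (trans (cong iD e) (iD∘jD y))))
    , (λ x → injV _ _ (iV∘jV (iV x))) , (λ x → injD _ _ (iD∘jD (iD x)))
    where
    jV = proj₁ ∘ surjV
    jD = proj₁ ∘ surjD
    iV∘jV : ∀ y → iV (jV y) ≡ y
    iV∘jV = proj₂ ∘ surjV
    iD∘jD : ∀ y → iD (jD y) ≡ y
    iD∘jD = proj₂ ∘ surjD

  factorisation-via-Iso : ∀ {ψ χ R G : BGraph B} {f : InjMorB ψ G} (g : InjMorB ψ χ) (g′ : InjMorB χ G)
    → g′ ∘ᴹ g ≗ᴹ f → Iso χ R → Σ (InjMorB ψ R) λ a → Σ (InjMorB R G) λ b → b ∘ᴹ a ≗ᴹ f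
  factorisation-via-Iso g g′ (eV , eD) I with Iso⇒leftInverse I
  ... | J , JIV , JID =
    proj₁ I ∘ᴹ g , g′ ∘ᴹ J ,
    (λ x → trans (cong (fV g′) (JIV (fV g x))) (eV x)) ,
    (λ x → trans (cong (fD g′) (JID (fD g x))) (eD x))

  FactorisationThrough : ∀ {ψ G : BGraph B} {n} → (Fin n → BGraph B) → InjMorB ψ G → Set
  FactorisationThrough {ψ} {G} {n} R f = Σ (Fin n) λ j → Σ (InjMorB ψ (R j)) λ a → Σ (InjMorB (R j) G) λ b → b ∘ᴹ a ≗ᴹ f

  VMap DMap : BGraph B → BGraph B → Set
  VMap χ G = Fin (nV (gr χ)) → Fin (nV (gr G))
  DMap χ G = Fin (nD (gr χ)) → Fin (nD (gr G))

  ∑Mor : (χ G : BGraph B) → (VMap χ G → DMap χ G → ℕ) → ℕ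
  ∑Mor χ G w = sumF (nV (gr χ)) (nV (gr G)) λ fV → sumF (nD (gr χ)) (nD (gr G)) (w fV)

  ∑Mor-cong : ∀ χ G {u v : VMap χ G → DMap χ G → ℕ} → (∀ fV fD → u fV fD ≡ v fV fD) → ∑Mor χ G u ≡ ∑Mor χ G v
  ∑Mor-cong χ G u≗v = sumF-cong (nV (gr χ)) (nV (gr G)) λ fV → sumF-cong (nD (gr χ)) (nD (gr G)) (u≗v fV)

  ∑Mor-mono : ∀ χ G {u v : VMap χ G → DMap χ G → ℕ} → (∀ fV fD → u fV fD ≤ v fV fD) → ∑Mor χ G u ≤ ∑Mor χ G v
  ∑Mor-mono χ G u≤v = sumF-mono (nV (gr χ)) (nV (gr G)) λ fV → sumF-mono (nD (gr χ)) (nD (gr G)) (u≤v fV)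

  ∑Mor-*ˡ : ∀ χ G c (w : VMap χ G → DMap χ G → ℕ) → ∑Mor χ G (λ fV fD → c * w fV fD) ≡ c * ∑Mor χ G w
  ∑Mor-*ˡ χ G c w = trans (sumF-cong (nV (gr χ)) (nV (gr G)) λ fV → sumF-*ˡ (nD (gr χ)) (nD (gr G)) c (w fV))
                          (sumF-*ˡ (nV (gr χ)) (nV (gr G)) c _)

  ∑Mor-*ʳ : ∀ χ G c (w : VMap χ G → DMap χ G → ℕ) → ∑Mor χ G (λ fV fD → w fV fD * c) ≡ ∑Mor χ G w * c
  ∑Mor-*ʳ χ G c w =
    trans (∑Mor-cong χ G λ fV fD → *-comm (w fV fD) c)
          (trans (∑Mor-*ˡ χ G c w) (*-comm c _))

  ∑Mor-comm : ∀ χ G χ′ G′ (w : VMap χ G → DMap χ G → VMap χ′ G′ → DMap χ′ G′ → ℕ)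
    → ∑Mor χ G (λ fV fD → ∑Mor χ′ G′ (w fV fD)) ≡ ∑Mor χ′ G′ (λ gV gD → ∑Mor χ G λ fV fD → w fV fD gV gD)
  ∑Mor-comm χ G χ′ G′ w = begin
    sumF a b (λ fV → sumF c d λ fD → sumF a′ b′ λ gV → sumF c′ d′ λ gD → w fV fD gV gD)
      ≡⟨ sumF-cong a b (λ fV → sumF-comm c d a′ b′ _) ⟩
    sumF a b (λ fV → sumF a′ b′ λ gV → sumF c d λ fD → sumF c′ d′ λ gD → w fV fD gV gD)
      ≡⟨ sumF-cong a b (λ fV → sumF-cong a′ b′ λ gV → sumF-comm c d c′ d′ _) ⟩
    sumF a b (λ fV → sumF a′ b′ λ gV → sumF c′ d′ λ gD → sumF c d λ fD → w fV fD gV gD)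
      ≡⟨ sumF-comm a b a′ b′ _ ⟩
    sumF a′ b′ (λ gV → sumF a b λ fV → sumF c′ d′ λ gD → sumF c d λ fD → w fV fD gV gD)
      ≡⟨ sumF-cong a′ b′ (λ gV → sumF-comm a b c′ d′ _) ⟩
    sumF a′ b′ (λ gV → sumF c′ d′ λ gD → sumF a b λ fV → sumF c d λ fD → w fV fD gV gD)
      ∎
    where
    open ≡-Reasoning
    a = nV (gr χ) ; b = nV (gr G) ; c = nD (gr χ) ; d = nD (gr G)
    a′ = nV (gr χ′) ; b′ = nV (gr G′) ; c′ = nD (gr χ′) ; d′ = nD (gr G′)

  ∑Mor-sumFin-comm : ∀ χ G n (w : VMap χ G → DMap χ G → Fin n → ℕ)
    → ∑Mor χ G (λ fV fD → sumFin n (w fV fD)) ≡ sumFin n (λ j → ∑Mor χ G λ fV fD → w fV fD j)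
  ∑Mor-sumFin-comm χ G n w =
    trans (sumF-cong a b λ fV → sumF-sum-map-comm c d (allFin n) (w fV))
          (sumF-sum-map-comm a b (allFin n) _)
    where a = nV (gr χ) ; b = nV (gr G) ; c = nD (gr χ) ; d = nD (gr G)

  term≤∑Mor : ∀ χ G (w : VMap χ G → DMap χ G → ℕ) gV gD
    → Σ (VMap χ G) λ fV → Σ (DMap χ G) λ fD → fV ≗ gV × fD ≗ gD × w fV fD ≤ ∑Mor χ G w
  term≤∑Mor χ G w gV gD with term≤sumF a b (λ fV → sumF c d (w fV)) gV
    where a = nV (gr χ) ; b = nV (gr G) ; c = nD (gr χ) ; d = nD (gr G)
  ... | fV , fV≗gV , inner≤ with term≤sumF (nD (gr χ)) (nD (gr G)) (w fV) gD
  ...   | fD , fD≗gD , wf≤ = fV , fD , fV≗gV , fD≗gD , ≤-trans wf≤ inner≤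

  ∑Mor-≗?-≤1 : ∀ χ G (gV : VMap χ G) (gD : DMap χ G)
    → ∑Mor χ G (λ fV fD → 𝟙 (does (fV ≗? gV)) * 𝟙 (does (fD ≗? gD))) ≤ 1
  ∑Mor-≗?-≤1 χ G gV gD = begin
    sumF a b (λ fV → sumF c d λ fD → 𝟙 (does (fV ≗? gV)) * 𝟙 (does (fD ≗? gD)))
      ≡⟨ sumF-cong a b (λ fV → sumF-*ˡ c d (𝟙 (does (fV ≗? gV))) _) ⟩
    sumF a b (λ fV → 𝟙 (does (fV ≗? gV)) * sumF c d λ fD → 𝟙 (does (fD ≗? gD)))
      ≤⟨ sumF-mono a b (λ fV → *-monoʳ-≤ (𝟙 (does (fV ≗? gV))) (sumF-≗?-≤1 c d gD)) ⟩
    sumF a b (λ fV → 𝟙 (does (fV ≗? gV)) * 1)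
      ≡⟨ sumF-cong a b (λ fV → *-identityʳ _) ⟩
    sumF a b (λ fV → 𝟙 (does (fV ≗? gV)))
      ≤⟨ sumF-≗?-≤1 a b gV ⟩
    1 ∎
    where
    open ≤-Reasoning
    a = nV (gr χ) ; b = nV (gr G) ; c = nD (gr χ) ; d = nD (gr G)

  module Factorisations {ψ G : BGraph B} {n} (R : Fin n → BGraph B) where

    valid : ∀ χ χ′ → VMap χ χ′ → DMap χ χ′ → ℕ
    valid χ χ′ uV uD = 𝟙 (does (isInjMorB? χ χ′ uV uD))

    weight : ∀ j → VMap ψ (R j) → DMap ψ (R j) → VMap (R j) G → DMap (R j) G → ℕ
    weight j aV aD bV bD = valid ψ (R j) aV aD * valid (R j) G bV bD

    composes-to : ∀ j → VMap ψ G → DMap ψ G → VMap ψ (R j) → DMap ψ (R j) → VMap (R j) G → DMap (R j) G → ℕ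
    composes-to j uV uD aV aD bV bD = 𝟙 (does (uV ≗? (bV ∘ aV))) * 𝟙 (does (uD ≗? (bD ∘ aD)))

    factorisations : ∀ j → VMap ψ G → DMap ψ G → ℕ
    factorisations j uV uD = ∑Mor ψ (R j) λ aV aD → ∑Mor (R j) G λ bV bD →
      weight j aV aD bV bD * composes-to j uV uD aV aD bV bD

    valid≤factorisations : (∀ (f : InjMorB ψ G) → FactorisationThrough R f)
      → ∀ uV uD → valid ψ G uV uD ≤ sumFin n (λ j → factorisations j uV uD)
    valid≤factorisations factor uV uD = by-cases (isInjMorB? ψ G uV uD)
      where
      by-cases : (f? : Dec (IsInjMorB ψ G uV uD)) → 𝟙 (does f?) ≤ sumFin n (λ j → factorisations j uV uD)
      by-cases (no _) = z≤n
      by-cases (yes f-inj) with factor (injMor uV uD f-inj)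
      ... | j , a , b , eV , eD
        with term≤∑Mor ψ (R j) (λ aV aD → ∑Mor (R j) G λ bV bD →
               weight j aV aD bV bD * composes-to j uV uD aV aD bV bD) (fV a) (fD a)
      ... | aV , aD , aV≗ , aD≗ , a-term≤
        with term≤∑Mor (R j) G (λ bV bD → weight j aV aD bV bD * composes-to j uV uD aV aD bV bD) (fV b) (fD b)
      ... | bV , bD , bV≗ , bD≗ , b-term≤ =
        ≤-trans (≤-reflexive (sym term≡1))
          (≤-trans b-term≤ (≤-trans a-term≤ (∈⇒≤sum-map (allFin n) (λ j → factorisations j uV uD) (∈-allFin j))))
        where
        term≡1 : weight j aV aD bV bD * composes-to j uV uD aV aD bV bD ≡ 1
        term≡1 = cong₂ _*_
          (cong₂ _*_ (𝟙-does≡1 (isInjMorB? ψ (R j) aV aD) (IsInjMorB-resp-≗ ψ (R j) (isInj a) (sym ∘ aV≗) (sym ∘ aD≗)))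
                     (𝟙-does≡1 (isInjMorB? (R j) G bV bD) (IsInjMorB-resp-≗ (R j) G (isInj b) (sym ∘ bV≗) (sym ∘ bD≗))))
          (cong₂ _*_ (𝟙-does≡1 (uV ≗? (bV ∘ aV)) λ x → trans (sym (eV x)) (trans (cong (fV b) (sym (aV≗ x))) (sym (bV≗ _))))
                     (𝟙-does≡1 (uD ≗? (bD ∘ aD)) λ x → trans (sym (eD x)) (trans (cong (fD b) (sym (aD≗ x))) (sym (bD≗ _)))))

    -- Given a and b, the candidate f = b ∘ a is counted at most once.
    factorisations≤N*N : ∀ j → ∑Mor ψ G (factorisations j) ≤ N ψ (R j) * N (R j) G
    factorisations≤N*N j = begin
      ∑Mor ψ G (λ uV uD → ∑Mor ψ (R j) λ aV aD → ∑Mor (R j) G λ bV bD → weight j aV aD bV bD * composes-to j uV uD aV aD bV bD)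
        ≡⟨ ∑Mor-comm ψ G ψ (R j) _ ⟩
      ∑Mor ψ (R j) (λ aV aD → ∑Mor ψ G λ uV uD → ∑Mor (R j) G λ bV bD → weight j aV aD bV bD * composes-to j uV uD aV aD bV bD)
        ≡⟨ ∑Mor-cong ψ (R j) (λ aV aD → ∑Mor-comm ψ G (R j) G _) ⟩
      ∑Mor ψ (R j) (λ aV aD → ∑Mor (R j) G λ bV bD → ∑Mor ψ G λ uV uD → weight j aV aD bV bD * composes-to j uV uD aV aD bV bD)
        ≤⟨ ∑Mor-mono ψ (R j) (λ aV aD → ∑Mor-mono (R j) G λ bV bD → unique-composite aV aD bV bD) ⟩
      ∑Mor ψ (R j) (λ aV aD → ∑Mor (R j) G λ bV bD → valid ψ (R j) aV aD * valid (R j) G bV bD)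
        ≡⟨ ∑Mor-cong ψ (R j) (λ aV aD → ∑Mor-*ˡ (R j) G (valid ψ (R j) aV aD) _) ⟩
      ∑Mor ψ (R j) (λ aV aD → valid ψ (R j) aV aD * N (R j) G)
        ≡⟨ ∑Mor-*ʳ ψ (R j) (N (R j) G) _ ⟩
      N ψ (R j) * N (R j) G ∎
      where
      open ≤-Reasoning
      unique-composite : ∀ aV aD bV bD
        → ∑Mor ψ G (λ uV uD → weight j aV aD bV bD * composes-to j uV uD aV aD bV bD) ≤ weight j aV aD bV bD
      unique-composite aV aD bV bD = begin
        ∑Mor ψ G (λ uV uD → weight j aV aD bV bD * composes-to j uV uD aV aD bV bD)
          ≡⟨ ∑Mor-*ˡ ψ G (weight j aV aD bV bD) _ ⟩
        weight j aV aD bV bD * ∑Mor ψ G (λ uV uD → composes-to j uV uD aV aD bV bD)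
          ≤⟨ *-monoʳ-≤ (weight j aV aD bV bD) (∑Mor-≗?-≤1 ψ G (bV ∘ aV) (bD ∘ aD)) ⟩
        weight j aV aD bV bD * 1
          ≡⟨ *-identityʳ _ ⟩
        weight j aV aD bV bD ∎

  N≤∑N*N-if-factorisations : ∀ {ψ G : BGraph B} n (R : Fin n → BGraph B)
    → (∀ (f : InjMorB ψ G) → FactorisationThrough R f)
    → N ψ G ≤ sumFin n (λ j → N ψ (R j) * N (R j) G)
  N≤∑N*N-if-factorisations {ψ} {G} n R factor = begin
    N ψ G                                                         ≤⟨ ∑Mor-mono ψ G (valid≤factorisations factor) ⟩
    ∑Mor ψ G (λ uV uD → sumFin n (λ j → factorisations j uV uD)) ≡⟨ ∑Mor-sumFin-comm ψ G n _ ⟩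
    sumFin n (λ j → ∑Mor ψ G (factorisations j))                  ≤⟨ sum-map-mono (allFin n) factorisations≤N*N ⟩
    sumFin n (λ j → N ψ (R j) * N (R j) G)                        ∎
    where
    open ≤-Reasoning
    open Factorisations {ψ} {G} R

-- Orbit representatives, images and induced subgraphs

module _ (G : Graph) where

  orbitRep : Fin (nD G) → Fin (nD G)
  orbitRep e with toℕ e ≤ℕ? toℕ (ι G e)
  ... | yes _ = e
  ... | no  _ = ι G e

  orbitRep-isOrbitRep : ∀ e → T (isOrbitRep G (orbitRep e))
  orbitRep-isOrbitRep e with toℕ e ≤ℕ? toℕ (ι G e)
  ... | yes e≤ιe = ≤⇒≤ᵇ e≤ιe
  ... | no  e≰ιe = ≤⇒≤ᵇ (subst (λ x → toℕ (ι G e) ≤ toℕ x) (sym (ι-invol G e)) (<⇒≤ (≰⇒> e≰ιe)))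

  orbitRep-inOrbit : ∀ e → orbitRep e ≡ e ⊎ orbitRep e ≡ ι G e
  orbitRep-inOrbit e with toℕ e ≤ℕ? toℕ (ι G e)
  ... | yes _ = inj₁ refl
  ... | no  _ = inj₂ refl

  orbitRep-injective-on-orbits : ∀ e₁ e₂ → orbitRep e₁ ≡ orbitRep e₂ → e₁ ≡ e₂ ⊎ e₁ ≡ ι G e₂
  orbitRep-injective-on-orbits e₁ e₂ eq with orbitRep-inOrbit e₁ | orbitRep-inOrbit e₂
  ... | inj₁ r₁ | inj₁ r₂ = inj₁ (trans (sym r₁) (trans eq r₂))
  ... | inj₁ r₁ | inj₂ r₂ = inj₂ (trans (sym r₁) (trans eq r₂))
  ... | inj₂ r₁ | inj₁ r₂ = inj₂ (trans (sym (ι-invol G e₁)) (cong (ι G) (trans (sym r₁) (trans eq r₂))))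
  ... | inj₂ r₁ | inj₂ r₂ =
    inj₁ (trans (sym (ι-invol G e₁)) (trans (cong (ι G) (trans (sym r₁) (trans eq r₂))) (ι-invol G e₂)))

  isOrbitRep-unique : ∀ d → T (isOrbitRep G d) → T (isOrbitRep G (ι G d)) → ι G d ≡ d
  isOrbitRep-unique d d-rep ιd-rep = toℕ-injective (≤-antisym
    (subst (λ x → toℕ (ι G d) ≤ toℕ x) (ι-invol G d) (≤ᵇ⇒≤ _ _ ιd-rep))
    (≤ᵇ⇒≤ _ _ d-rep))

module _ {B : Graph} {χ G : BGraph B} (φ : InjMorB χ G) where

  private
    φ-h : ∀ d → fV φ (h (gr χ) d) ≡ h (gr G) (fD φ d)
    φ-h = proj₁ (proj₁ (isInj φ))
    φ-ι : ∀ d → fD φ (ι (gr χ) d) ≡ ι (gr G) (fD φ d)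
    φ-ι = proj₁ (proj₂ (proj₂ (proj₁ (isInj φ))))

  imageV : Fin (nV (gr G)) → Bool
  imageV v = does (any? λ x → fV φ x ≟ v)

  imageD : Fin (nD (gr G)) → Bool
  imageD d = does (any? λ e → fD φ e ≟ d)

  imageV⁺ : ∀ x → T (imageV (fV φ x))
  imageV⁺ x = does⁺ (any? λ y → fV φ y ≟ fV φ x) (x , refl)

  imageD⁺ : ∀ e → T (imageD (fD φ e))
  imageD⁺ e = does⁺ (any? λ y → fD φ y ≟ fD φ e) (e , refl)

  imageV⁻ : ∀ {v} → T (imageV v) → ∃ λ x → fV φ x ≡ v
  imageV⁻ {v} = does⁻ (any? λ x → fV φ x ≟ v)

  imageD⁻ : ∀ {d} → T (imageD d) → ∃ λ e → fD φ e ≡ d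
  imageD⁻ {d} = does⁻ (any? λ e → fD φ e ≟ d)

  image-h-closed : ∀ d → T (imageD d) → T (imageV (h (gr G) d))
  image-h-closed d d∈ with imageD⁻ d∈
  ... | e , refl = subst (T ∘ imageV) (φ-h e) (imageV⁺ (h (gr χ) e))

  image-ι-closed : ∀ d → T (imageD d) → T (imageD (ι (gr G) d))
  image-ι-closed d d∈ with imageD⁻ d∈
  ... | e , refl = subst (T ∘ imageD) (φ-ι e) (imageD⁺ (ι (gr χ) e))

  vertices≤image : nV (gr χ) ≤ count (nV (gr G)) imageV
  vertices≤image = subst (_≤ count (nV (gr G)) imageV) (count-true (nV (gr χ)))
    (count-injection _ _ _ _ (λ x _ → fV φ x) (λ x _ → imageV⁺ x) (λ x y _ _ → proj₁ (proj₂ (isInj φ)) x y))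

  -- Each edge of the image is the image of an edge of χ; send it to that edge's orbit representative.
  image-edges≤ : count (nD (gr G)) (λ d → imageD d ∧ isOrbitRep (gr G) d) ≤ numEdges (gr χ)
  image-edges≤ = subst (count (nD (gr G)) (λ d → imageD d ∧ isOrbitRep (gr G) d) ≤_)
    (sym (countFin≡count (nD (gr χ)) (isOrbitRep (gr χ))))
    (count-injection _ _ _ _ edge (λ d p → orbitRep-isOrbitRep (gr χ) (preimage d p)) edge-injective)
    where
    preimage : ∀ d → T (imageD d ∧ isOrbitRep (gr G) d) → Fin (nD (gr χ))
    preimage d p = proj₁ (imageD⁻ (proj₁ (Equivalence.to T-∧ p)))
    edge : ∀ d → T (imageD d ∧ isOrbitRep (gr G) d) → Fin (nD (gr χ))
    edge d p = orbitRep (gr χ) (preimage d p)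
    edge-injective : ∀ d₁ d₂ p₁ p₂ → edge d₁ p₁ ≡ edge d₂ p₂ → d₁ ≡ d₂
    edge-injective d₁ d₂ p₁ p₂ eq
      with imageD⁻ (proj₁ (Equivalence.to T-∧ p₁)) | imageD⁻ (proj₁ (Equivalence.to T-∧ p₂))
         | orbitRep-injective-on-orbits (gr χ) (preimage d₁ p₁) (preimage d₂ p₂) eq
    ... | e₁ , refl | e₂ , refl | inj₁ refl = refl
    ... | e₁ , refl | e₂ , refl | inj₂ refl =
      trans (sym ιd₂≡d₁) (isOrbitRep-unique (gr G) _ d₂-rep (subst (T ∘ isOrbitRep (gr G)) (sym ιd₂≡d₁) d₁-rep))
      where
      ιd₂≡d₁ : ι (gr G) (fD φ e₂) ≡ fD φ (ι (gr χ) e₂)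
      ιd₂≡d₁ = sym (φ-ι e₂)
      d₁-rep = proj₂ (Equivalence.to T-∧ p₁)
      d₂-rep = proj₂ (Equivalence.to T-∧ p₂)

module _ {B : Graph} where

  record Subgraph (G : BGraph B) : Set where
    field
      inV      : Fin (nV (gr G)) → Bool
      inD      : Fin (nD (gr G)) → Bool
      h-closed : ∀ d → T (inD d) → T (inV (h (gr G) d))
      ι-closed : ∀ d → T (inD d) → T (inD (ι (gr G) d))

  ordOf : (G : BGraph B) → (Fin (nV (gr G)) → Bool) → (Fin (nD (gr G)) → Bool) → ℤ
  ordOf G PV PD = count (nD (gr G)) (λ d → PD d ∧ isOrbitRep (gr G) d) ⊖ count (nV (gr G)) PV

  module Induced {G : BGraph B} (S : Subgraph G) where
    open Subgraph S
    private
      nVG = nV (gr G)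
      nDG = nD (gr G)
      V = count nVG inV
      D = count nDG inD
      emV = select nVG inV
      emD = select nDG inD

    t-closed : ∀ d → T (inD d) → T (inV (t (gr G) d))
    t-closed d d∈ = subst (T ∘ inV) h∘ι≡t (h-closed (ι (gr G) d) (ι-closed d d∈))
      where
      h∘ι≡t : h (gr G) (ι (gr G) d) ≡ t (gr G) d
      h∘ι≡t = trans (sym (tι≡h (gr G) (ι (gr G) d))) (cong (t (gr G)) (ι-invol (gr G) d))

    h′ t′ : Fin D → Fin V
    h′ d = position nVG inV (h (gr G) (emD d)) (h-closed _ (select-satisfies nDG inD d))
    t′ d = position nVG inV (t (gr G) (emD d)) (t-closed _ (select-satisfies nDG inD d))

    ι′ : Fin D → Fin D
    ι′ d = position nDG inD (ι (gr G) (emD d)) (ι-closed _ (select-satisfies nDG inD d))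

    emV-h′ : ∀ d → emV (h′ d) ≡ h (gr G) (emD d)
    emV-h′ d = select-position nVG inV _ _
    emV-t′ : ∀ d → emV (t′ d) ≡ t (gr G) (emD d)
    emV-t′ d = select-position nVG inV _ _
    emD-ι′ : ∀ d → emD (ι′ d) ≡ ι (gr G) (emD d)
    emD-ι′ d = select-position nDG inD _ _

    graph : Graph
    graph = record
      { nV = V ; nD = D ; h = h′ ; t = t′ ; ι = ι′
      ; ι-invol = λ d → select-injective nDG inD _ _
          (trans (emD-ι′ (ι′ d)) (trans (cong (ι (gr G)) (emD-ι′ d)) (ι-invol (gr G) (emD d))))
      ; tι≡h = λ d → select-injective nVG inV _ _
          (trans (emV-t′ (ι′ d)) (trans (cong (t (gr G)) (emD-ι′ d)) (trans (tι≡h (gr G) (emD d)) (sym (emV-h′ d)))))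
      }

    bgraph : BGraph B
    bgraph = record
      { gr = graph
      ; πV = πV G ∘ emV
      ; πD = πD G ∘ emD
      ; πh = λ d → trans (cong (πV G) (emV-h′ d)) (πh G (emD d))
      ; πt = λ d → trans (cong (πV G) (emV-t′ d)) (πt G (emD d))
      ; πι = λ d → trans (cong (πD G) (emD-ι′ d)) (πι G (emD d))
      }

    inclusion : InjMorB bgraph G
    inclusion = injMor emV emD
      ((emV-h′ , emV-t′ , emD-ι′ , (λ _ → refl) , (λ _ → refl)) , select-injective nVG inV , select-injective nDG inD)

    inclusionV-in : ∀ v → T (inV (fV inclusion v))
    inclusionV-in = select-satisfies nVG inV

    inclusionD-in : ∀ d → T (inD (fD inclusion d))
    inclusionD-in = select-satisfies nDG inD

    restrict : ∀ {χ} (f : InjMorB χ G) → (∀ x → T (inV (fV f x))) → (∀ e → T (inD (fD f e)))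
      → Σ (InjMorB χ bgraph) λ g → inclusion ∘ᴹ g ≗ᴹ f
    restrict {χ} (injMor uV uD ((uh , ut , uι , uπV , uπD) , injV , injD)) uV∈ uD∈ =
      injMor gV gD
        (( (λ d → select-injective nVG inV _ _
               (trans (emV-gV _) (trans (uh d) (trans (cong (h (gr G)) (sym (emD-gD d))) (sym (emV-h′ (gD d)))))))
         , (λ d → select-injective nVG inV _ _
               (trans (emV-gV _) (trans (ut d) (trans (cong (t (gr G)) (sym (emD-gD d))) (sym (emV-t′ (gD d)))))))
         , (λ d → select-injective nDG inD _ _
               (trans (emD-gD _) (trans (uι d) (trans (cong (ι (gr G)) (sym (emD-gD d))) (sym (emD-ι′ (gD d)))))))
         , (λ v → trans (cong (πV G) (emV-gV v)) (uπV v))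
         , (λ d → trans (cong (πD G) (emD-gD d)) (uπD d)) )
        , (λ x y e → injV x y (trans (sym (emV-gV x)) (trans (cong emV e) (emV-gV y))))
        , (λ x y e → injD x y (trans (sym (emD-gD x)) (trans (cong emD e) (emD-gD y)))))
      , emV-gV , emD-gD
      where
      gV = λ x → position nVG inV (uV x) (uV∈ x)
      gD = λ e → position nDG inD (uD e) (uD∈ e)
      emV-gV : ∀ x → emV (gV x) ≡ uV x
      emV-gV x = select-position nVG inV _ _
      emD-gD : ∀ e → emD (gD e) ≡ uD e
      emD-gD e = select-position nDG inD _ _

    -- emD is order preserving, so it maps orbit representatives exactly to orbit representatives.
    isOrbitRep-emD : ∀ d → isOrbitRep graph d ≡ isOrbitRep (gr G) (emD d)
    isOrbitRep-emD d = T-injective (mk⇔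
      (λ p → ≤⇒≤ᵇ (subst (≤-emD d) (emD-ι′ d) (Equivalence.to (select-≤⇔ nDG inD d (ι′ d)) (≤ᵇ⇒≤ _ _ p))))
      (λ p → ≤⇒≤ᵇ (Equivalence.from (select-≤⇔ nDG inD d (ι′ d)) (subst (≤-emD d) (sym (emD-ι′ d)) (≤ᵇ⇒≤ _ _ p)))))
      where
      ≤-emD : Fin D → Fin nDG → Set
      ≤-emD d x = toℕ (emD d) ≤ toℕ x

    ord-bgraph : ord graph ≡ ordOf G inV inD
    ord-bgraph = cong (_⊖ V) (begin
      countFin D (isOrbitRep graph)                  ≡⟨ countFin≡count D _ ⟩
      count D (isOrbitRep graph)                     ≡⟨ count-cong D isOrbitRep-emD ⟩
      count D (isOrbitRep (gr G) ∘ emD)              ≡⟨ count-select nDG inD (isOrbitRep (gr G)) ⟩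
      count nDG (λ d → inD d ∧ isOrbitRep (gr G) d)  ∎)
      where open ≡-Reasoning

-- Ψ-embeddings, Ψ⁺ ∩ G, and unions of images

numEdges≤maxEdges : ∀ {B m} (Ψ : Fin m → BGraph B) i → numEdges (gr (Ψ i)) ≤ maxEdges Ψ
numEdges≤maxEdges {m = m} Ψ i = ∈⇒≤foldr-⊔ _ (∈-map⁺ (λ i → numEdges (gr (Ψ i))) (∈-allFin i))

module _ {B : Graph} {m : ℕ} (Ψ : Fin m → BGraph B) where

  ΨEmbedding : BGraph B → Set
  ΨEmbedding G = Σ (Fin m) λ i → InjMorB (Ψ i) G

  module _ {G : BGraph B} where

    -- coreV and coreD are both of the form someΨEmbedding test.
    private
      MorTest : Set
      MorTest = ∀ {a c} → (Fin a → Fin (nV (gr G))) → (Fin c → Fin (nD (gr G))) → Bool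

      someΨEmbedding : MorTest → Bool
      someΨEmbedding test = any (λ i →
        anyF (nV (gr (Ψ i))) (nV (gr G)) λ fV →
        anyF (nD (gr (Ψ i))) (nD (gr G)) λ fD →
          does (isInjMorB? (Ψ i) G fV fD) ∧ test fV fD) (allFin m)

      someΨEmbedding⁺ : (test : MorTest)
        → (∀ {a c} {fV fV′ : Fin a → _} {fD fD′ : Fin c → _}
             → fV′ ≗ fV → fD′ ≗ fD → T (test fV fD) → T (test fV′ fD′))
        → (e : ΨEmbedding G) → T (test (fV (proj₂ e)) (fD (proj₂ e))) → T (someΨEmbedding test)
      someΨEmbedding⁺ test test-resp (i , φ) passes = any⁺ _ (Any.map (λ { refl →
        anyF⁺ _ _ _ (fV φ) λ gV gV≗ →
        anyF⁺ _ _ _ (fD φ) λ gD gD≗ →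
          Equivalence.from T-∧
            ( does⁺ (isInjMorB? (Ψ i) G gV gD) (IsInjMorB-resp-≗ (Ψ i) G (isInj φ) (sym ∘ gV≗) (sym ∘ gD≗))
            , test-resp gV≗ gD≗ passes ) }) (∈-allFin i))

      someΨEmbedding⁻ : (test : MorTest) → T (someΨEmbedding test)
        → Σ (ΨEmbedding G) λ e → T (test (fV (proj₂ e)) (fD (proj₂ e)))
      someΨEmbedding⁻ test passes with satisfied (any⁻ _ (allFin m) passes)
      ... | i , passes₁ with anyF⁻ _ _ _ passes₁
      ... | gV , passes₂ with anyF⁻ _ _ _ passes₂
      ... | gD , passes₃ with Equivalence.to T-∧ passes₃
      ... | valid , test-ok = (i , injMor gV gD (does⁻ (isInjMorB? (Ψ i) G gV gD) valid)) , test-ok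

    coreV⁺ : (e : ΨEmbedding G) → ∀ x → T (coreV Ψ G (fV (proj₂ e) x))
    coreV⁺ e x = someΨEmbedding⁺ (λ uV _ → does (any? λ y → uV y ≟ fV (proj₂ e) x))
      (λ { uV′≗uV _ → does⁺ (any? _) ∘ (λ { (y , eq) → y , trans (uV′≗uV y) eq }) ∘ does⁻ (any? _) })
      e (imageV⁺ (proj₂ e) x)

    coreD⁺ : (e : ΨEmbedding G) → ∀ x → T (coreD Ψ G (fD (proj₂ e) x))
    coreD⁺ e x = someΨEmbedding⁺ (λ _ uD → does (any? λ y → uD y ≟ fD (proj₂ e) x))
      (λ { _ uD′≗uD → does⁺ (any? _) ∘ (λ { (y , eq) → y , trans (uD′≗uD y) eq }) ∘ does⁻ (any? _) })
      e (imageD⁺ (proj₂ e) x)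

    coreD⁻ : ∀ {d} → T (coreD Ψ G d) → Σ (ΨEmbedding G) λ e → T (imageD (proj₂ e) d)
    coreD⁻ {d} = someΨEmbedding⁻ (λ _ fD → does (any? λ x → fD x ≟ d))

    InΨ+⇒factorsThroughCore : ∀ {ψ} → InΨ+ Ψ ψ → (f : InjMorB ψ G) → FactorsThroughCore Ψ f
    InΨ+⇒factorsThroughCore (k , idx , φ , coverV , coverD) f =
      (λ v → let j , x , φx≡v = coverV v in
        Equivalence.to T-≡ (subst (T ∘ coreV Ψ G ∘ fV f) φx≡v (coreV⁺ (idx j , f ∘ᴹ φ j) x))) ,
      (λ d → let j , e , φe≡d = coverD d in
        Equivalence.to T-≡ (subst (T ∘ coreD Ψ G ∘ fD f) φe≡d (coreD⁺ (idx j , f ∘ᴹ φ j) e)))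

    unionV : List (ΨEmbedding G) → Fin (nV (gr G)) → Bool
    unionV ℓ v = any (λ e → imageV (proj₂ e) v) ℓ

    unionD : List (ΨEmbedding G) → Fin (nD (gr G)) → Bool
    unionD ℓ d = any (λ e → imageD (proj₂ e) d) ℓ

    unionV⁺ : ∀ {ℓ e v} → e ∈ ℓ → T (imageV (proj₂ e) v) → T (unionV ℓ v)
    unionV⁺ e∈ℓ v∈ = any⁺ _ (Any.map (λ { refl → v∈ }) e∈ℓ)

    unionD⁺ : ∀ {ℓ e d} → e ∈ ℓ → T (imageD (proj₂ e) d) → T (unionD ℓ d)
    unionD⁺ e∈ℓ d∈ = any⁺ _ (Any.map (λ { refl → d∈ }) e∈ℓ)

    union : List (ΨEmbedding G) → Subgraph G
    union ℓ = record
      { inV = unionV ℓ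
      ; inD = unionD ℓ
      ; h-closed = λ d d∈ → any⁺ _ (Any.map (λ {e} → image-h-closed (proj₂ e) d) (any⁻ _ ℓ d∈))
      ; ι-closed = λ d d∈ → any⁺ _ (Any.map (λ {e} → image-ι-closed (proj₂ e) d) (any⁻ _ ℓ d∈))
      }

    unionV⊆coreV : ∀ ℓ v → T (unionV ℓ v) → T (coreV Ψ G v)
    unionV⊆coreV ℓ v v∈ with satisfied (any⁻ _ ℓ v∈)
    ... | e , v∈im with imageV⁻ (proj₂ e) v∈im
    ... | x , refl = coreV⁺ e x

    ordΨ≡ordOf-core : ordΨ Ψ G ≡ ordOf G (coreV Ψ G) (coreD Ψ G)
    ordΨ≡ordOf-core = cong₂ _⊖_ (countFin≡count (nD (gr G)) (λ d → coreD Ψ G d ∧ isOrbitRep (gr G) d))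
                                (countFin≡count (nV (gr G)) (coreV Ψ G))

    ordΨ≤ordOf-union : ∀ ℓ → (∀ d → T (coreD Ψ G d) → T (unionD ℓ d)) → ordΨ Ψ G ≤ℤ ordOf G (unionV ℓ) (unionD ℓ)
    ordΨ≤ordOf-union ℓ coreD⊆ = subst (_≤ℤ ordOf G (unionV ℓ) (unionD ℓ)) (sym ordΨ≡ordOf-core)
      (⊖-mono-≤ (count-mono (nD (gr G)) λ d → Equivalence.from T-∧ ∘ Data.Product.map₁ (coreD⊆ d) ∘ Equivalence.to T-∧)
                (count-mono (nV (gr G)) (unionV⊆coreV ℓ)))

    ordOf-union-∷ : ∀ e ℓ → ordOf G (unionV (e ∷ ℓ)) (unionD (e ∷ ℓ)) ≤ℤ ordOf G (unionV ℓ) (unionD ℓ) +ℤ + maxEdges Ψ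
    ordOf-union-∷ (i , φ) ℓ = ℤ.≤-trans
      (⊖-mono-≤ edges≤ (count-mono (nV (gr G)) {unionV ℓ} λ v → Equivalence.from T-∨ ∘ inj₂))
      (ℤ.≤-reflexive (sym (ℤ.distribˡ-⊖-+-pos (maxEdges Ψ)
        (count nDG (λ d → unionD ℓ d ∧ rep d)) (count (nV (gr G)) (unionV ℓ)))))
      where
      nDG = nD (gr G)
      rep = isOrbitRep (gr G)
      edges≤ : count nDG (λ d → unionD ((i , φ) ∷ ℓ) d ∧ rep d) ≤ count nDG (λ d → unionD ℓ d ∧ rep d) + maxEdges Ψ
      edges≤ = begin
        count nDG (λ d → unionD ((i , φ) ∷ ℓ) d ∧ rep d)
          ≤⟨ count-mono nDG (λ d → Equivalence.from T-∨ ∘ split d ∘ Equivalence.to T-∧) ⟩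
        count nDG (λ d → (unionD ℓ d ∧ rep d) ∨ (imageD φ d ∧ rep d))
          ≤⟨ count-∨ nDG (λ d → unionD ℓ d ∧ rep d) (λ d → imageD φ d ∧ rep d) ⟩
        count nDG (λ d → unionD ℓ d ∧ rep d) + count nDG (λ d → imageD φ d ∧ rep d)
          ≤⟨ +-monoʳ-≤ (count nDG (λ d → unionD ℓ d ∧ rep d)) (≤-trans (image-edges≤ φ) (numEdges≤maxEdges Ψ i)) ⟩
        count nDG (λ d → unionD ℓ d ∧ rep d) + maxEdges Ψ ∎
        where
        open ≤-Reasoning
        split : ∀ d → T (unionD ((i , φ) ∷ ℓ) d) × T (rep d) → T (unionD ℓ d ∧ rep d) ⊎ T (imageD φ d ∧ rep d)
        split d (d∈ , d-rep) with Equivalence.to T-∨ d∈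
        ... | inj₁ d∈φ = inj₂ (Equivalence.from T-∧ (d∈φ , d-rep))
        ... | inj₂ d∈ℓ = inj₁ (Equivalence.from T-∧ (d∈ℓ , d-rep))

    union-InΨ+ : ∀ {e} ℓ → e ∈ ℓ → InΨ+ Ψ (Induced.bgraph (union ℓ))
    union-InΨ+ {e} ℓ e∈ℓ = length ℓ , proj₁ ∘ member , proj₁ ∘ lift , coverV , coverD
      where
      open Induced (union ℓ)
      -- e is listed twice so that the family is indexed by a Fin (suc _)
      member : Fin (suc (length ℓ)) → ΨEmbedding G
      member = lookup (e ∷ ℓ)
      member∈ℓ : ∀ j → member j ∈ ℓ
      member∈ℓ zero    = e∈ℓ
      member∈ℓ (suc j) = ∈-lookup j
      lift : ∀ j → Σ (InjMorB (Ψ (proj₁ (member j))) bgraph) λ g → inclusion ∘ᴹ g ≗ᴹ proj₂ (member j)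
      lift j = restrict (proj₂ (member j)) (unionV⁺ (member∈ℓ j) ∘ imageV⁺ (proj₂ (member j)))
                                           (unionD⁺ (member∈ℓ j) ∘ imageD⁺ (proj₂ (member j)))
      inclusion-injectiveV = proj₁ (proj₂ (isInj inclusion))
      inclusion-injectiveD = proj₂ (proj₂ (isInj inclusion))
      coverV : ∀ v → ∃ λ j → ∃ λ x → fV (proj₁ (lift j)) x ≡ v
      coverV v with any⁻ (λ e → imageV (proj₂ e) (fV inclusion v)) ℓ (inclusionV-in v)
      ... | v∈some with imageV⁻ (proj₂ (lookup ℓ (Any.index v∈some))) (lookup-index v∈some)
      ... | x , eq = suc (Any.index v∈some) , x ,
        inclusion-injectiveV _ _ (trans (proj₁ (proj₂ (lift (suc (Any.index v∈some)))) x) eq)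
      coverD : ∀ d → ∃ λ j → ∃ λ x → fD (proj₁ (lift j)) x ≡ d
      coverD d with any⁻ (λ e → imageD (proj₂ e) (fD inclusion d)) ℓ (inclusionD-in d)
      ... | d∈some with imageD⁻ (proj₂ (lookup ℓ (Any.index d∈some))) (lookup-index d∈some)
      ... | x , eq = suc (Any.index d∈some) , x ,
        inclusion-injectiveD _ _ (trans (proj₂ (proj₂ (lift (suc (Any.index d∈some)))) x) eq)

    private
      witness : ∀ d → Dec (T (coreD Ψ G d)) → List (ΨEmbedding G)
      witness d (yes d∈) = proj₁ (coreD⁻ d∈) ∷ []
      witness d (no _)   = []

      witness-covers : ∀ d d? → T (coreD Ψ G d) → Any (λ e → T (imageD (proj₂ e) d)) (witness d d?)
      witness-covers d (yes d∈) _  = here (proj₂ (coreD⁻ d∈))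
      witness-covers d (no d∉)  d∈ = ⊥-elim (d∉ d∈)

    coreWitnesses : List (ΨEmbedding G)
    coreWitnesses = concatMap (λ d → witness d (T? (coreD Ψ G d))) (allFin (nD (gr G)))

    coreD⊆unionD-coreWitnesses : ∀ ℓ d → T (coreD Ψ G d) → T (unionD (coreWitnesses ++ ℓ) d)
    coreD⊆unionD-coreWitnesses ℓ d d∈ =
      any⁺ _ (++⁺ˡ (concatMap⁺ _ (Any.map (λ { refl → witness-covers d _ d∈ }) (∈-allFin d))))

    module _ {ψ : BGraph B} (ψ∈Ψ+ : InΨ+ Ψ ψ) (f : InjMorB ψ G) where
      private
        k = proj₁ ψ∈Ψ+
        idx = proj₁ (proj₂ ψ∈Ψ+)
        φ = proj₁ (proj₂ (proj₂ ψ∈Ψ+))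
        coverV = proj₁ (proj₂ (proj₂ (proj₂ ψ∈Ψ+)))
        coverD = proj₂ (proj₂ (proj₂ (proj₂ ψ∈Ψ+)))

      pieces : List (ΨEmbedding G)
      pieces = map (λ j → idx j , f ∘ᴹ φ j) (allFin (suc k))

      piece∈pieces : ∀ j → (idx j , f ∘ᴹ φ j) ∈ pieces
      piece∈pieces j = ∈-map⁺ (λ j → idx j , f ∘ᴹ φ j) (∈-allFin j)

      imageV-covered-by-pieces : ∀ u → Σ (ΨEmbedding G) λ e → e ∈ pieces × T (imageV (proj₂ e) (fV f u))
      imageV-covered-by-pieces u with coverV u
      ... | j , x , refl = _ , piece∈pieces j , imageV⁺ (f ∘ᴹ φ j) x

      imageD-covered-by-pieces : ∀ u → Σ (ΨEmbedding G) λ e → e ∈ pieces × T (imageD (proj₂ e) (fD f u))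
      imageD-covered-by-pieces u with coverD u
      ... | j , x , refl = _ , piece∈pieces j , imageD⁺ (f ∘ᴹ φ j) x

      unionD-pieces⊆imageD : ∀ d → T (unionD pieces d) → T (imageD f d)
      unionD-pieces⊆imageD d d∈ with satisfied (map⁻ (any⁻ _ pieces d∈))
      ... | j , d∈piece with imageD⁻ (f ∘ᴹ φ j) d∈piece
      ... | e , refl = imageD⁺ f (fD (φ j) e)

      ordOf-pieces≤ord : ordOf G (unionV pieces) (unionD pieces) ≤ℤ ord (gr ψ)
      ordOf-pieces≤ord = ⊖-mono-≤
        (≤-trans (count-mono (nD (gr G)) λ d →
                   Equivalence.from T-∧ ∘ Data.Product.map₁ (unionD-pieces⊆imageD d) ∘ Equivalence.to T-∧)
                 (image-edges≤ f))
        (≤-trans (vertices≤image f) (count-mono (nV (gr G)) imageV⊆unionV))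
        where
        imageV⊆unionV : ∀ v → T (imageV f v) → T (unionV pieces v)
        imageV⊆unionV v v∈ with imageV⁻ f v∈
        ... | u , refl = let _ , e∈ , u∈ = imageV-covered-by-pieces u in unionV⁺ e∈ u∈

      ordStage : List (ΨEmbedding G) → ℤ
      ordStage ℓ = ordOf G (unionV (ℓ ++ pieces)) (unionD (ℓ ++ pieces))

      factorisation-through-Ψ+ : (r : ℕ) → + r ≤ℤ ordΨ Ψ G → ord (gr ψ) <ℤ + r
        → Σ (BGraph B) λ ψ′ → InΨ+ Ψ ψ′ × + r ≤ℤ ord (gr ψ′) × ord (gr ψ′) <ℤ + (r + maxEdges Ψ)
          × Σ (InjMorB ψ ψ′) λ g → Σ (InjMorB ψ′ G) λ g′ → g′ ∘ᴹ g ≗ᴹ f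
      factorisation-through-Ψ+ r r≤ordΨG ordψ<r
        with first-crossing ordStage (maxEdges Ψ) (+ r) (λ e ℓ → ordOf-union-∷ e (ℓ ++ pieces))
               (ℤ.≤-<-trans ordOf-pieces≤ord ordψ<r) coreWitnesses
               (ℤ.≤-trans r≤ordΨG (ordΨ≤ordOf-union (coreWitnesses ++ pieces) (coreD⊆unionD-coreWitnesses pieces)))
      ... | ℓ , r≤Oℓ , Oℓ<r+s =
        bgraph , union-InΨ+ (ℓ ++ pieces) (∈-++⁺ʳ ℓ (piece∈pieces zero)) ,
        subst (+ r ≤ℤ_) (sym ord-bgraph) r≤Oℓ , subst (_<ℤ + (r + maxEdges Ψ)) (sym ord-bgraph) Oℓ<r+s ,
        proj₁ f-restricted , inclusion , proj₂ f-restricted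
        where
        open Induced (union (ℓ ++ pieces))
        f-restricted = restrict f
          (λ u → let _ , e∈ , u∈ = imageV-covered-by-pieces u in unionV⁺ (∈-++⁺ʳ ℓ e∈) u∈)
          (λ u → let _ , e∈ , u∈ = imageD-covered-by-pieces u in unionD⁺ (∈-++⁺ʳ ℓ e∈) u∈)

      factorisation-through-representative : (r : ℕ) → + r ≤ℤ ordΨ Ψ G → ord (gr ψ) <ℤ + r
        → ∀ {n} (reps : Fin n → BGraph B) → IsRepSystem Ψ r (r + maxEdges Ψ) reps
        → FactorisationThrough reps f
      factorisation-through-representative r r≤ordΨG ordψ<r reps (_ , _ , represented) =
        let ψ′ , ψ′∈Ψ+ , r≤ordψ′ , ordψ′<r+s , g , g′ , g′∘g≗f = factorisation-through-Ψ+ r r≤ordΨG ordψ<r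
            j , ψ′≅reps-j = represented ψ′ ψ′∈Ψ+ r≤ordψ′ ordψ′<r+s
        in j , factorisation-via-Iso {f = f} g g′ g′∘g≗f ψ′≅reps-j

lemma8p5 : (B : Graph) (m : ℕ) (Ψ : Fin m → BGraph B)
    → (∀ r → FiniteΨ+< Ψ r)
    → let s = maxEdges Ψ in
      -- (1)
      (∀ (ψ G : BGraph B) → InΨ+ Ψ ψ → (f : InjMorB ψ G) → FactorsThroughCore Ψ f)
      -- (2), factorization
      × (∀ (r : ℕ) (G ψ : BGraph B) → + r ≤ℤ ordΨ Ψ G → InΨ+ Ψ ψ → ord (gr ψ) <ℤ + r
          → (f : InjMorB ψ G)
          → Σ (BGraph B) λ ψ' → InΨ+ Ψ ψ' × + r ≤ℤ ord (gr ψ') × ord (gr ψ') <ℤ + (r + s)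
            × Σ (InjMorB ψ ψ') λ g → Σ (InjMorB ψ' G) λ g' →
                (∀ v → fV g' (fV g v) ≡ fV f v) × (∀ d → fD g' (fD g d) ≡ fD f d))
      -- (2), counting inequality (sum over any system of representatives
      -- of the classes in Ψ^+_{<r+s} \ Ψ^+_{<r})
      × (∀ (r : ℕ) (G ψ : BGraph B) → + r ≤ℤ ordΨ Ψ G → InΨ+ Ψ ψ → ord (gr ψ) <ℤ + r
          → (n : ℕ) (reps : Fin n → BGraph B) → IsRepSystem Ψ r (r + s) reps
          → N ψ G ≤ sumFin n (λ j → N ψ (reps j) * N (reps j) G))
lemma8p5 B m Ψ _ =
  (λ ψ G → InΨ+⇒factorsThroughCore Ψ {G}) ,
  (λ r G ψ r≤ordΨG ψ∈Ψ+ ordψ<r f → factorisation-through-Ψ+ Ψ {G} ψ∈Ψ+ f r r≤ordΨG ordψ<r) ,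
  (λ r G ψ r≤ordΨG ψ∈Ψ+ ordψ<r n reps reps-system → N≤∑N*N-if-factorisations {ψ = ψ} {G} n reps λ f →
    factorisation-through-representative Ψ {G} ψ∈Ψ+ f r r≤ordΨG ordψ<r reps reps-system)
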